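{- For every $k\geq2$ and every $n\geq2$, the families $\mathrm{SLT}_k$ and $\mathrm{REG}_n^Z$ are incomparable, and for every $n\geq2$ the families $\mathrm{SLT}$ and $\mathrm{REG}_n^Z$ are incomparable (incomparable meaning neither is a subset of the other).
   Context: For $k\geq1$, a language $L$ over an alphabet $V$ is strictly locally $k$-testable (family $\mathrm{SLT}_k$) if there are sets $B,I,E\subseteq V^k$ and a finite set $F$ of words of length at most $k-1$ such that $L$ consists of the words of $F$ together with exactly those words $a_1a_2\cdots a_m$ ($m\geq k$, $a_i\in V$) for which $a_1\cdots a_k\in B$, $a_{j+1}\cdots a_{j+k}\in I$ for every $j$ with $1\leq j\leq m-k-1$, and $a_{m-k+1}\cdots a_m\in E$. $\mathrm{SLT}=\bigcup_{k\geq1}\mathrm{SLT}_k$. $\mathrm{REG}_n^Z$ is the family of regular languages accepted by some deterministic finite automaton (with total transition function) with at most $n$ states. -}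

module Defs where

open import Data.Nat using (ℕ; zero; suc; _+_; _∸_; _≤_; _<_)
open import Data.Fin using (Fin)
open import Data.Bool using (Bool; true)
open import Data.List using (List; []; _∷_; length; drop; foldl)
open import Data.List.Relation.Unary.All using (All)
open import Data.List.Membership.Propositional using (_∈_)
open import Data.Vec using (Vec; []; _∷_)
open import Data.Maybe using (Maybe; just; nothing)
import Data.Maybe as Maybe
open import Data.Product using (Σ; _×_; ∃-syntax)
open import Data.Sum using (_⊎_)
open import Data.Empty using (⊥)
open import Relation.Binary.PropositionalEquality using (_≡_)
open import Relation.Nullary using (¬_)
open import Function.Bundles using (_⇔_)

Language : ℕ → Set₁
Language m = List (Fin m) → Set

Family : Set₁
Family = (m : ℕ) → Language m → Set

_⊆ᶠ_ : Family → Family → Set₁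
A ⊆ᶠ B = ∀ m (L : Language m) → A m L → B m L

Incomparable : Family → Family → Set₁
Incomparable A B = ¬ (A ⊆ᶠ B) × ¬ (B ⊆ᶠ A)

window : {V : Set} (k : ℕ) → List V → Maybe (Vec V k)
window zero    _        = just []
window (suc k) []       = nothing
window (suc k) (x ∷ xs) = Maybe.map (x ∷_) (window k xs)

holds : {V : Set} {k : ℕ} → (Vec V k → Bool) → Maybe (Vec V k) → Set
holds P (just v) = P v ≡ true
holds P nothing  = ⊥

-- Condition on words a₁⋯aₘ with m ≥ k from the definition of SLT_k:
-- a₁⋯a_k ∈ B, a_{j+1}⋯a_{j+k} ∈ I for 1 ≤ j ≤ m-k-1, a_{m-k+1}⋯aₘ ∈ E.
LongOK : {V : Set} (k : ℕ) (B I E : Vec V k → Bool) → List V → Set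
LongOK k B I E w =
  (k ≤ length w)
  × holds B (window k w)
  × (∀ j → 1 ≤ j → j + k + 1 ≤ length w → holds I (window k (drop j w)))
  × holds E (window k (drop (length w ∸ k) w))

SLTk : ℕ → Family
SLTk k m L =
  1 ≤ k ×
  Σ (Vec (Fin m) k → Bool) λ B →
  Σ (Vec (Fin m) k → Bool) λ I →
  Σ (Vec (Fin m) k → Bool) λ E →
  Σ (List (List (Fin m))) λ F →
    All (λ u → length u < k) F
    × (∀ w → L w ⇔ (w ∈ F ⊎ LongOK k B I E w))

SLT : Family
SLT m L = ∃[ k ] SLTk k m L

record DFA (s m : ℕ) : Set where
  field
    start : Fin s
    δ     : Fin s → Fin m → Fin s
    final : Fin s → Bool

accepts : {s m : ℕ} → DFA s m → List (Fin m) → Set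
accepts A w = DFA.final A (foldl (DFA.δ A) (DFA.start A) w) ≡ true

REGZ : ℕ → Family
REGZ n m L =
  ∃[ s ] (s ≤ n) × Σ (DFA s m) λ A → ∀ w → L w ⇔ accepts A w

{-# OPTIONS --safe #-}
-- Membership of a long word in an SLT_k language is decided by its k-windows.
-- On a constant word aᴹ every window is aᵏ, so an SLT_k language cannot tell aᴹ
-- from aᴹ⁺¹ once aᴹ has an interior window; the two-state parity automaton does.
-- Conversely, "the first two letters agree" is SLT_k for every k ≥ 2, but over
-- n + 1 letters a DFA with at most n states sends two distinct first letters
-- a ≠ b to the same state (pigeonhole), so it cannot tell a·aᵏ⁻¹ from b·aᵏ⁻¹.
module Submission where

open import Defs
open import Data.Nat using (ℕ; zero; suc; _+_; _*_; _∸_; _≤_; _<_; z≤n; s≤s)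
open import Data.Nat.Properties
  using (≤-refl; ≤-reflexive; ≤-trans; <⇒≤; m≤n⇒m≤1+n; m≤m*n; m+n≤o⇒m≤o; m∸n+n≡m; ≤⇒≯)
open import Data.Fin using (Fin; _≟_)
open import Data.Fin.Properties using (pigeonhole; <⇒≢)
open import Data.Bool using (Bool; true; false)
open import Data.Bool.Properties using (T-≡)
open import Data.List using (List; []; _∷_; length; drop; foldl; replicate)
open import Data.List.Properties using (length-replicate)
open import Data.List.Relation.Unary.All using (All; []; lookup)
open import Data.List.Membership.Propositional using (_∉_)
import Data.Vec as Vec
open import Data.Vec using (Vec; _∷_)
import Data.Maybe as Maybe
open import Data.Maybe using (just)
open import Data.Product using (_×_; _,_; ∃₂)
open import Data.Sum using (inj₁; inj₂)
open import Relation.Binary.PropositionalEquality using (_≡_; _≢_; refl; sym; cong; subst)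
open import Relation.Nullary using (¬_; contradiction)
open import Relation.Nullary.Decidable using (⌊_⌋; toWitness; fromWitness)
open import Function using (id; const; _∘_)
open import Function.Bundles using (Equivalence; mk⇔)

private
  variable
    A : Set
    k m n M M′ : ℕ

window-replicate : (a : A) → k ≤ M → window k (replicate M a) ≡ just (Vec.replicate k a)
window-replicate {k = zero}  a _         = refl
window-replicate {k = suc k} a (s≤s k≤M) rewrite window-replicate a k≤M = refl

window-drop-replicate : ∀ j (a : A) → j + k ≤ M →
                        window k (drop j (replicate M a)) ≡ just (Vec.replicate k a)
window-drop-replicate             zero    a h       = window-replicate a h
window-drop-replicate {M = suc M} (suc j) a (s≤s h) = window-drop-replicate j a h

window-suffix-replicate : (a : A) → k ≤ M →
                          window k (drop (length (replicate M a) ∸ k) (replicate M a))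
                            ≡ just (Vec.replicate k a)
window-suffix-replicate {k = k} {M} a k≤M rewrite length-replicate M {a} =
  window-drop-replicate (M ∸ k) a (≤-reflexive (m∸n+n≡m k≤M))

interior⇒long : 1 + k + 1 ≤ M → k ≤ M
interior⇒long {k = k} h = m+n≤o⇒m≤o k (<⇒≤ h)

module _ {B I E : Vec A k → Bool} (a : A) where

  LongOK-replicate : k ≤ M → B (Vec.replicate k a) ≡ true → I (Vec.replicate k a) ≡ true →
                     E (Vec.replicate k a) ≡ true → LongOK k B I E (replicate M a)
  LongOK-replicate {M = M} k≤M b i e =
      subst (k ≤_) (sym (length-replicate M)) k≤M
    , subst (holds B) (sym (window-drop-replicate 0 a k≤M)) b
    , (λ j _ j+k+1≤ → subst (holds I) (sym (window-drop-replicate j a (interior j j+k+1≤))) i)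
    , subst (holds E) (sym (window-suffix-replicate a k≤M)) e
    where
    interior : ∀ j → j + k + 1 ≤ length (replicate M a) → j + k ≤ M
    interior j h = m+n≤o⇒m≤o (j + k) (subst (j + k + 1 ≤_) (length-replicate M) h)

  -- 1 + k + 1 ≤ M is exactly when LongOK inspects the interior window at position 1.
  LongOK-replicate⁻¹ : 1 + k + 1 ≤ M → LongOK k B I E (replicate M a) →
                       B (Vec.replicate k a) ≡ true × I (Vec.replicate k a) ≡ true
                         × E (Vec.replicate k a) ≡ true
  LongOK-replicate⁻¹ {M = M} 1+k+1≤M (_ , b , i , e) =
      subst (holds B) (window-drop-replicate 0 a k≤M) b
    , subst (holds I) (window-drop-replicate 1 a (m+n≤o⇒m≤o (1 + k) 1+k+1≤M))
        (i 1 (s≤s z≤n) (subst (1 + k + 1 ≤_) (sym (length-replicate M)) 1+k+1≤M))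
    , subst (holds E) (window-suffix-replicate a k≤M) e
    where
    k≤M : k ≤ M
    k≤M = interior⇒long 1+k+1≤M

long∉short : {F : List (List A)} {w : List A} →
             All (λ u → length u < k) F → k ≤ length w → w ∉ F
long∉short short k≤∣w∣ w∈F = ≤⇒≯ k≤∣w∣ (lookup short w∈F)

SLTk-replicate : {L : Language m} (a : Fin m) → SLTk k m L → 1 + k + 1 ≤ M → k ≤ M′ →
                 L (replicate M a) → L (replicate M′ a)
SLTk-replicate {k = k} {M = M} a (_ , _ , _ , _ , _ , short , L⇔) 1+k+1≤M k≤M′ aᴹ∈L
  with Equivalence.to (L⇔ _) aᴹ∈L
... | inj₁ aᴹ∈F =
  contradiction aᴹ∈F
    (long∉short short (subst (k ≤_) (sym (length-replicate M)) (interior⇒long 1+k+1≤M)))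
... | inj₂ ok with LongOK-replicate⁻¹ a 1+k+1≤M ok
...   | b , i , e = Equivalence.from (L⇔ _) (inj₂ (LongOK-replicate a k≤M′ b i e))

toggle : Fin 2 → Fin 1 → Fin 2
toggle Fin.zero           _ = Fin.suc Fin.zero
toggle (Fin.suc Fin.zero) _ = Fin.zero

isEven : Fin 2 → Bool
isEven Fin.zero           = true
isEven (Fin.suc Fin.zero) = false

parity : DFA 2 1
parity = record { start = Fin.zero ; δ = toggle ; final = isEven }

EvenLength : Language 1
EvenLength = accepts parity

foldl-toggle-double : ∀ t q (a : Fin 1) → foldl toggle q (replicate (t * 2) a) ≡ q
foldl-toggle-double zero    q                  a = refl
foldl-toggle-double (suc t) Fin.zero           a = foldl-toggle-double t Fin.zero a
foldl-toggle-double (suc t) (Fin.suc Fin.zero) a = foldl-toggle-double t (Fin.suc Fin.zero) a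

EvenLength-double : ∀ t (a : Fin 1) → EvenLength (replicate (t * 2) a)
EvenLength-double t a = subst (λ q → isEven q ≡ true) (sym (foldl-toggle-double t Fin.zero a)) refl

¬EvenLength-odd : ∀ t (a : Fin 1) → ¬ EvenLength (replicate (1 + t * 2) a)
¬EvenLength-odd t a accepted
  with () ← subst (λ q → isEven q ≡ true) (foldl-toggle-double t (Fin.suc Fin.zero) a) accepted

EvenLength-REGZ : 2 ≤ n → REGZ n 1 EvenLength
EvenLength-REGZ 2≤n = 2 , 2≤n , parity , λ w → mk⇔ id id

¬EvenLength-SLTk : ¬ SLTk k 1 EvenLength
¬EvenLength-SLTk {k = k} slt =
  ¬EvenLength-odd t Fin.zero
    (SLTk-replicate Fin.zero slt (m≤m*n t 2) k≤1+t*2 (EvenLength-double t Fin.zero))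
  where
  t : ℕ
  t = 1 + k + 1
  k≤1+t*2 : k ≤ 1 + t * 2
  k≤1+t*2 = m≤n⇒m≤1+n (≤-trans (interior⇒long ≤-refl) (m≤m*n t 2))

firstTwoEqual : Vec (Fin m) (2 + k) → Bool
firstTwoEqual (x ∷ y ∷ _) = ⌊ x ≟ y ⌋

FirstTwoEqual : ℕ → (m : ℕ) → Language m
FirstTwoEqual k m = LongOK (2 + k) firstTwoEqual (const true) (const true)

FirstTwoEqual-SLTk : SLTk (2 + k) m (FirstTwoEqual k m)
FirstTwoEqual-SLTk = s≤s z≤n , firstTwoEqual , const true , const true , [] , [] ,
  λ w → mk⇔ inj₂ λ { (inj₁ ()) ; (inj₂ ok) → ok }

FirstTwoEqual-replicate : (a : Fin m) → FirstTwoEqual k m (replicate (2 + k) a)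
FirstTwoEqual-replicate a =
  LongOK-replicate a ≤-refl (Equivalence.to T-≡ (fromWitness refl)) refl refl

¬FirstTwoEqual-distinct : {a b : Fin m} → b ≢ a → ¬ FirstTwoEqual k m (b ∷ replicate (1 + k) a)
¬FirstTwoEqual-distinct {a = a} {b} b≢a (_ , first , _) =
  b≢a (toWitness (Equivalence.from T-≡ b≟a))
  where
  b≟a : ⌊ b ≟ a ⌋ ≡ true
  b≟a = subst (holds firstTwoEqual) (cong (Maybe.map (b ∷_)) (window-replicate a ≤-refl)) first

DFA-merges-first-letters : {s : ℕ} (D : DFA s m) → s < m →
                           ∃₂ λ a b → a ≢ b × ∀ w → accepts D (a ∷ w) → accepts D (b ∷ w)
DFA-merges-first-letters D s<m
  with a , b , a<b , δa≡δb ← pigeonhole s<m (DFA.δ D (DFA.start D)) =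
  a , b , <⇒≢ a<b , λ w → subst (λ q → DFA.final D (foldl (DFA.δ D) q w) ≡ true) δa≡δb

¬FirstTwoEqual-REGZ : ¬ REGZ n (suc n) (FirstTwoEqual k (suc n))
¬FirstTwoEqual-REGZ {k = k} (s , s≤n , D , L⇔)
  with a , b , a≢b , a→b ← DFA-merges-first-letters D (s≤s s≤n) =
  ¬FirstTwoEqual-distinct (a≢b ∘ sym)
    (Equivalence.from (L⇔ _)
      (a→b (replicate (1 + k) a) (Equivalence.to (L⇔ _) (FirstTwoEqual-replicate a))))

SLTk⊈REGZ : ¬ (SLTk (2 + k) ⊆ᶠ REGZ n)
SLTk⊈REGZ {n = n} sub = ¬FirstTwoEqual-REGZ (sub (suc n) _ FirstTwoEqual-SLTk)

REGZ⊈SLTk : 2 ≤ n → ¬ (REGZ n ⊆ᶠ SLTk k)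
REGZ⊈SLTk 2≤n sub = ¬EvenLength-SLTk (sub 1 EvenLength (EvenLength-REGZ 2≤n))

lemma12 : (∀ k n → 2 ≤ k → 2 ≤ n → Incomparable (SLTk k) (REGZ n))
          × (∀ n → 2 ≤ n → Incomparable SLT (REGZ n))
lemma12 = SLTk-REGZ-incomparable , SLT-REGZ-incomparable
  where
  SLTk-REGZ-incomparable : ∀ k n → 2 ≤ k → 2 ≤ n → Incomparable (SLTk k) (REGZ n)
  SLTk-REGZ-incomparable (suc (suc k)) _ (s≤s (s≤s z≤n)) 2≤n =
    SLTk⊈REGZ , REGZ⊈SLTk 2≤n
  SLT-REGZ-incomparable : ∀ n → 2 ≤ n → Incomparable SLT (REGZ n)
  SLT-REGZ-incomparable _ 2≤n =
      (λ sub → SLTk⊈REGZ {k = 0} λ m L slt → sub m L (2 , slt))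
    , (λ sub → let k , slt = sub 1 EvenLength (EvenLength-REGZ 2≤n) in ¬EvenLength-SLTk slt)
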